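{- Let $r\ge 2$ and let $L$ be the set of all odd integers in $\{0,1,2,\ldots,\binom{n}{r}\}$. Then $f(n,r,n,L)=2^{\Theta(n^r)}$ as $n\to\infty$.
   Context: An $r$-graph is an $r$-uniform hypergraph. For a list $L\subseteq\{0,1,\ldots,\binom{k}{r}\}$, an $r$-graph $G$ is $(L,k)$-free if for every $i\in L$ there is no set of $k$ vertices of $G$ spanning exactly $i$ edges. $f(n,r,k,L)$ denotes the number of $(L,k)$-free $r$-graphs on the vertex set $[n]=\{1,\ldots,n\}$. -}

module Defs where

open import Data.Bool using (Bool; true; false; _∧_; not; if_then_else_)
open import Data.Nat using (ℕ; zero; suc; _≤ᵇ_; _≡ᵇ_; _%_)
open import Data.Nat.Combinatorics using (_C_)
open import Data.List using (List; []; _∷_; [_]; concatMap; filterᵇ; length; zip; map)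
open import Data.Bool.ListAction using (and)
open import Data.Vec using (Vec; []; _∷_; toList)
open import Data.Product using (_×_; _,_)
open import Data.Fin.Subset using (Subset; ∣_∣)

allVecs : (n : ℕ) → List (Vec Bool n)
allVecs zero = [ [] ]
allVecs (suc n) = concatMap (λ v → (false ∷ v) ∷ (true ∷ v) ∷ []) (allVecs n)

_⊆ᵇ_ : {n : ℕ} → Subset n → Subset n → Bool
[] ⊆ᵇ [] = true
(false ∷ s) ⊆ᵇ (_ ∷ t) = s ⊆ᵇ t
(true ∷ s) ⊆ᵇ (b ∷ t) = b ∧ (s ⊆ᵇ t)

rSets : (n r : ℕ) → List (Subset n)
rSets n r = filterᵇ (λ s → ∣ s ∣ ≡ᵇ r) (allVecs n)

-- An r-graph on vertex set [n]: its characteristic vector over the list of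
-- all r-subsets of [n] (entry true = that r-set is an edge).  This is a
-- bijective encoding of the r-uniform hypergraphs on [n].
RGraph : (n r : ℕ) → Set
RGraph n r = Vec Bool (length (rSets n r))

edgesIn : {n r : ℕ} → RGraph n r → Subset n → ℕ
edgesIn {n} {r} G S =
  length (filterᵇ (λ p → pickEdge p) (zip (toList G) (rSets n r)))
  where
    pickEdge : Bool × Subset n → Bool
    pickEdge (b , e) = b ∧ (e ⊆ᵇ S)

LkFree : {n r : ℕ} → (ℕ → Bool) → ℕ → RGraph n r → Bool
LkFree {n} L k G = and (map (λ S → not (L (edgesIn G S))) (rSets n k))

f : (n r k : ℕ) → (ℕ → Bool) → ℕ
f n r k L = length (filterᵇ (LkFree {n} {r} L k) (allVecs (length (rSets n r))))

oddUpTo : (n r : ℕ) → ℕ → Bool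
oddUpTo n r i = (i ≤ᵇ (n C r)) ∧ ((i % 2) ≡ᵇ 1)

{-# OPTIONS --safe #-}
-- There are only 2^C(n,r) r-graphs on [n] in all.  Conversely, the only n-subset of [n] is
-- [n] itself, which spans every edge, so every r-graph with an even number of edges is
-- (L,n)-free, and there are 2^(C(n,r)-1) of those.  Both exponents are of order n^r:
-- C(n,r) ≤ n^r, and for k = ⌊n/r⌋ ≥ n/2r, choosing one element from each of r disjoint
-- k-blocks of [n] gives C(n,r) ≥ k^r ≥ (n/2r)^r.
module Submission where

open import Data.Nat using (ℕ; _≤_; _<_; _*_; _^_)
open import Data.Product using (Σ; _×_)

open import Defs
open import Data.Bool using (Bool; true; false; not; _∧_; _xor_; T; if_then_else_)
open import Data.Bool.Properties using (∧-identityʳ; ∧-zeroʳ)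
open import Data.Nat using (zero; suc; _+_; _∸_; _/_; _%_; _≡ᵇ_; _≤ᵇ_; z≤n; s≤s; _≤′_; ≤′-refl; ≤′-step)
open import Data.Nat.Properties
open import Data.List.Properties using (length-filter)
open import Data.Nat.DivMod using (m≡m%n+[m/n]*n; m%n<n; n/n≡1; /-monoˡ-≤)
open import Data.Nat.Divisibility using (_∣_; ∣-refl; ∣m∣n⇒∣m+n; n∣m⇒m%n≡0; _∣0)
open import Data.Nat.Combinatorics using (_C_; nCk+nC[k+1]≡[n+1]C[k+1]; nCk≡nC[n∸k]; nC1≡n)
open import Data.Nat.Solver using (module +-*-Solver)
open import Data.List using (List; []; _∷_; concatMap; filterᵇ; length; zip; foldr)
import Data.List.Relation.Unary.All as All
open import Data.List.Relation.Unary.All.Properties using (all⁻; all-filter)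
open import Data.Vec as Vec using (Vec; toList)
open import Data.Vec.Properties using (length-toList)
open import Data.Fin.Subset using (Subset; ⊤; ∣_∣)
open import Data.Fin.Subset.Properties using (∣p∣≡n⇒p≡⊤)
open import Data.Product using (_,_)
open import Data.Empty using (⊥-elim)
open import Function using (id; _∘_)
open import Relation.Binary.PropositionalEquality
open import Relation.Nullary.Decidable using (T?)

private
  variable
    A B : Set
    n : ℕ

countᵇ : (A → Bool) → List A → ℕ
countᵇ p xs = length (filterᵇ p xs)

countᵇ-const-true : (xs : List A) → countᵇ (λ _ → true) xs ≡ length xs
countᵇ-const-true []       = refl
countᵇ-const-true (x ∷ xs) = cong suc (countᵇ-const-true xs)

countᵇ-const-false : (xs : List A) → countᵇ (λ _ → false) xs ≡ 0
countᵇ-const-false []       = refl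
countᵇ-const-false (x ∷ xs) = countᵇ-const-false xs

countᵇ-complement : (p : A → Bool) (xs : List A) → countᵇ p xs + countᵇ (not ∘ p) xs ≡ length xs
countᵇ-complement p [] = refl
countᵇ-complement p (x ∷ xs) with p x
... | true  = cong suc (countᵇ-complement p xs)
... | false = trans (+-suc _ _) (cong suc (countᵇ-complement p xs))

countᵇ-mono : (p q : A → Bool) (xs : List A) → (∀ x → T (p x) → T (q x)) →
              countᵇ p xs ≤ countᵇ q xs
countᵇ-mono p q [] p⇒q = z≤n
countᵇ-mono p q (x ∷ xs) p⇒q with p x in px | q x in qx
... | true  | true  = s≤s (countᵇ-mono p q xs p⇒q)
... | false | true  = m≤n⇒m≤1+n (countᵇ-mono p q xs p⇒q)
... | false | false = countᵇ-mono p q xs p⇒q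
... | true  | false = ⊥-elim (subst T qx (p⇒q x (subst T (sym px) _)))

countᵇ-concatMap-pair : (p : B → Bool) (g h : A → B) (xs : List A) →
  countᵇ p (concatMap (λ x → g x ∷ h x ∷ []) xs) ≡ countᵇ (p ∘ g) xs + countᵇ (p ∘ h) xs
countᵇ-concatMap-pair p g h [] = refl
countᵇ-concatMap-pair p g h (x ∷ xs) with p (g x)
... | true  with p (h x)
...   | true  = cong suc (trans (cong suc (countᵇ-concatMap-pair p g h xs)) (sym (+-suc _ _)))
...   | false = cong suc (countᵇ-concatMap-pair p g h xs)
countᵇ-concatMap-pair p g h (x ∷ xs) | false with p (h x)
...   | true  = trans (cong suc (countᵇ-concatMap-pair p g h xs)) (sym (+-suc _ _))
...   | false = countᵇ-concatMap-pair p g h xs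

countᵇ-zip-fst : (q : Bool × A → Bool) → (∀ b a → q (b , a) ≡ b) →
  (bs : List Bool) (as : List A) → length bs ≡ length as →
  countᵇ q (zip bs as) ≡ countᵇ id bs
countᵇ-zip-fst q q≡fst [] [] _ = refl
countᵇ-zip-fst q q≡fst (b ∷ bs) (a ∷ as) eq with q (b , a) | q≡fst b a
... | true  | refl = cong suc (countᵇ-zip-fst q q≡fst bs as (suc-injective eq))
... | false | refl = countᵇ-zip-fst q q≡fst bs as (suc-injective eq)

countᵇ-allVecs-suc : (p : Vec Bool (suc n) → Bool) → countᵇ p (allVecs (suc n)) ≡
  countᵇ (p ∘ (false Vec.∷_)) (allVecs n) + countᵇ (p ∘ (true Vec.∷_)) (allVecs n)
countᵇ-allVecs-suc {n} p = countᵇ-concatMap-pair p _ _ (allVecs n)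

length-allVecs : ∀ n → length (allVecs n) ≡ 2 ^ n
length-allVecs zero    = refl
length-allVecs (suc n) = begin
  length (allVecs (suc n))                                      ≡⟨ countᵇ-const-true (allVecs (suc n)) ⟨
  countᵇ (λ _ → true) (allVecs (suc n))                         ≡⟨ countᵇ-allVecs-suc {n} (λ _ → true) ⟩
  countᵇ (λ _ → true) (allVecs n) + countᵇ (λ _ → true) (allVecs n)
    ≡⟨ cong₂ _+_ (countᵇ-const-true (allVecs n)) (countᵇ-const-true (allVecs n)) ⟩
  length (allVecs n) + length (allVecs n)                       ≡⟨ cong₂ _+_ (length-allVecs n) (length-allVecs n) ⟩
  2 ^ n + 2 ^ n                                                 ≡⟨ cong (2 ^ n +_) (+-identityʳ (2 ^ n)) ⟨
  2 ^ suc n                                                     ∎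
  where open ≡-Reasoning

length-rSets : ∀ n r → length (rSets n r) ≡ n C r
length-rSets zero    zero    = refl
length-rSets zero    (suc r) = refl
length-rSets (suc n) zero    = begin
  length (rSets (suc n) 0)                                    ≡⟨ countᵇ-allVecs-suc {n} (λ s → ∣ s ∣ ≡ᵇ 0) ⟩
  length (rSets n 0) + countᵇ (λ _ → false) (allVecs n)       ≡⟨ cong₂ _+_ (length-rSets n 0) (countᵇ-const-false (allVecs n)) ⟩
  n C 0 + 0                                                   ≡⟨ +-identityʳ (n C 0) ⟩
  suc n C 0                                                   ∎
  where open ≡-Reasoning
length-rSets (suc n) (suc r) = begin
  length (rSets (suc n) (suc r))                ≡⟨ countᵇ-allVecs-suc {n} (λ s → ∣ s ∣ ≡ᵇ suc r) ⟩
  length (rSets n (suc r)) + length (rSets n r) ≡⟨ cong₂ _+_ (length-rSets n (suc r)) (length-rSets n r) ⟩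
  n C suc r + n C r                             ≡⟨ +-comm (n C suc r) (n C r) ⟩
  n C r + n C suc r                             ≡⟨ nCk+nC[k+1]≡[n+1]C[k+1] n r ⟩
  suc n C suc r                                 ∎
  where open ≡-Reasoning

nCk≤n^k : ∀ n k → n C k ≤ n ^ k
nCk≤n^k zero    zero    = ≤-refl
nCk≤n^k zero    (suc k) = z≤n
nCk≤n^k (suc n) zero    = ≤-refl
nCk≤n^k (suc n) (suc k) = begin
  suc n C suc k           ≡⟨ nCk+nC[k+1]≡[n+1]C[k+1] n k ⟨
  n C k + n C suc k       ≤⟨ +-mono-≤ (nCk≤n^k n k) (nCk≤n^k n (suc k)) ⟩
  suc n * n ^ k           ≤⟨ *-monoʳ-≤ (suc n) (^-monoˡ-≤ k (n≤1+n n)) ⟩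
  suc n ^ suc k           ∎
  where open ≤-Reasoning

nCk≤[1+n]Ck : ∀ n k → n C k ≤ suc n C k
nCk≤[1+n]Ck n zero    = ≤-refl
nCk≤[1+n]Ck n (suc k) = ≤-trans (m≤n+m (n C suc k) (n C k)) (≤-reflexive (nCk+nC[k+1]≡[n+1]C[k+1] n k))

C-monoˡ-≤ : ∀ {m n} k → m ≤ n → m C k ≤ n C k
C-monoˡ-≤ k m≤n = go (≤⇒≤′ m≤n)
  where
    go : ∀ {m n} → m ≤′ n → m C k ≤ n C k
    go ≤′-refl        = ≤-refl
    go (≤′-step m≤′n) = ≤-trans (go m≤′n) (nCk≤[1+n]Ck _ k)

1+k≤nCk : ∀ {n k} → k < n → suc k ≤ n C k
1+k≤nCk {n} {k} k<n = begin
  suc k               ≡⟨ nC1≡n (suc k) ⟨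
  suc k C 1           ≡⟨ cong (suc k C_) (m+n∸n≡m 1 k) ⟨
  suc k C (suc k ∸ k) ≡⟨ nCk≡nC[n∸k] (n≤1+n k) ⟨
  suc k C k           ≤⟨ C-monoˡ-≤ k k<n ⟩
  n C k               ∎
  where open ≤-Reasoning

m*nCk≤[m+n]C[1+k] : ∀ m n k → m * (n C k) ≤ (m + n) C suc k
m*nCk≤[m+n]C[1+k] zero    n k = z≤n
m*nCk≤[m+n]C[1+k] (suc m) n k = begin
  n C k + m * (n C k)                  ≤⟨ +-mono-≤ (C-monoˡ-≤ k (m≤n+m n m)) (m*nCk≤[m+n]C[1+k] m n k) ⟩
  (m + n) C k + (m + n) C suc k        ≡⟨ nCk+nC[k+1]≡[n+1]C[k+1] (m + n) k ⟩
  (suc m + n) C suc k                  ∎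
  where open ≤-Reasoning

m^k≤[k*m]Ck : ∀ m k → m ^ k ≤ (k * m) C k
m^k≤[k*m]Ck m zero    = ≤-refl
m^k≤[k*m]Ck m (suc k) = ≤-trans (*-monoʳ-≤ m (m^k≤[k*m]Ck m k)) (m*nCk≤[m+n]C[1+k] m (k * m) k)

^-distrib-* : ∀ m n k → (m * n) ^ k ≡ m ^ k * n ^ k
^-distrib-* m n zero    = refl
^-distrib-* m n (suc k) = begin
  m * n * (m * n) ^ k           ≡⟨ cong (m * n *_) (^-distrib-* m n k) ⟩
  m * n * (m ^ k * n ^ k)       ≡⟨ solve 4 (λ m n x y → m :* n :* (x :* y) := m :* x :* (n :* y)) refl m n (m ^ k) (n ^ k) ⟩
  m * m ^ k * (n * n ^ k)       ∎
  where
    open ≡-Reasoning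
    open +-*-Solver

n^k≤nCk*[2k]^k : ∀ {n} k → k ≤ n → n ^ k ≤ (n C k) * (2 * k) ^ k
n^k≤nCk*[2k]^k     zero      _   = ≤-refl
n^k≤nCk*[2k]^k {n} k@(suc _) k≤n = begin
  n ^ k                       ≤⟨ ^-monoˡ-≤ k n≤q*2k ⟩
  (q * (2 * k)) ^ k           ≡⟨ ^-distrib-* q (2 * k) k ⟩
  q ^ k * (2 * k) ^ k         ≤⟨ *-monoˡ-≤ ((2 * k) ^ k) q^k≤nCk ⟩
  (n C k) * (2 * k) ^ k       ∎
  where
    open ≤-Reasoning
    q = n / k
    n≡r+k*q : n ≡ n % k + k * q
    n≡r+k*q = trans (m≡m%n+[m/n]*n n k) (cong (n % k +_) (*-comm q k))
    1≤q : 1 ≤ q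
    1≤q = ≤-trans (≤-reflexive (sym (n/n≡1 k))) (/-monoˡ-≤ k k≤n)
    q^k≤nCk : q ^ k ≤ n C k
    q^k≤nCk = ≤-trans (m^k≤[k*m]Ck q k)
      (C-monoˡ-≤ k (≤-trans (m≤n+m (k * q) (n % k)) (≤-reflexive (sym n≡r+k*q))))
    n≤q*2k : n ≤ q * (2 * k)
    n≤q*2k = begin
      n                 ≡⟨ n≡r+k*q ⟩
      n % k + k * q     ≤⟨ +-monoˡ-≤ (k * q) (<⇒≤ (m%n<n n k)) ⟩
      k + k * q         ≤⟨ +-monoˡ-≤ (k * q) (≤-trans (≤-reflexive (sym (*-identityʳ k))) (*-monoʳ-≤ k 1≤q)) ⟩
      k * q + k * q     ≡⟨ solve 2 (λ k q → k :* q :+ k :* q := q :* (con 2 :* k)) refl k q ⟩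
      q * (2 * k)       ∎
      where open +-*-Solver

odd? : List Bool → Bool
odd? = foldr _xor_ false

trues : List Bool → ℕ
trues = countᵇ id

trues-parity : ∀ bs → if odd? bs then 2 ∣ suc (trues bs) else 2 ∣ trues bs
trues-parity []           = 2 ∣0
trues-parity (false ∷ bs) = trues-parity bs
trues-parity (true ∷ bs) with odd? bs | trues-parity bs
... | false | 2∣t   = ∣m∣n⇒∣m+n ∣-refl 2∣t
... | true  | 2∣1+t = 2∣1+t

even⇒2∣trues : ∀ bs → T (not (odd? bs)) → 2 ∣ trues bs
even⇒2∣trues bs even with odd? bs | trues-parity bs
... | false | 2∣t = 2∣t

evenWeight-count : ∀ m → countᵇ (λ v → not (odd? (toList v))) (allVecs m) ≡ 2 ^ (m ∸ 1)
evenWeight-count zero    = refl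
evenWeight-count (suc m) = begin
  countᵇ even (allVecs (suc m))                                 ≡⟨ countᵇ-allVecs-suc {m} even ⟩
  countᵇ even (allVecs m) + countᵇ (not ∘ even) (allVecs m)     ≡⟨ countᵇ-complement even (allVecs m) ⟩
  length (allVecs m)                                            ≡⟨ length-allVecs m ⟩
  2 ^ m                                                         ∎
  where
    open ≡-Reasoning
    even : ∀ {k} → Vec Bool k → Bool
    even v = not (odd? (toList v))

even∉oddUpTo : ∀ n r {i} → 2 ∣ i → T (not (oddUpTo n r i))
even∉oddUpTo n r {i} 2∣i rewrite n∣m⇒m%n≡0 i 2 2∣i | ∧-zeroʳ (i ≤ᵇ n C r) = _

⊆ᵇ⊤ : (s : Subset n) → s ⊆ᵇ ⊤ ≡ true
⊆ᵇ⊤ Vec.[]          = refl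
⊆ᵇ⊤ (false Vec.∷ s) = ⊆ᵇ⊤ s
⊆ᵇ⊤ (true Vec.∷ s)  = ⊆ᵇ⊤ s

edgesIn-⊤ : ∀ {n r} (G : RGraph n r) → edgesIn {n} {r} G ⊤ ≡ trues (toList G)
edgesIn-⊤ {n} {r} G = countᵇ-zip-fst _ (λ b e → trans (cong (b ∧_) (⊆ᵇ⊤ e)) (∧-identityʳ b))
  (toList G) (rSets n r) (length-toList G)

evenGraph⇒free : ∀ {n r} (G : RGraph n r) → T (not (odd? (toList G))) → T (LkFree {n} {r} (oddUpTo n r) n G)
evenGraph⇒free {n} {r} G even =
  all⁻ (λ S → not (oddUpTo n r (edgesIn {n} {r} G S)))
       (All.map spansEven (all-filter (T? ∘ λ s → ∣ s ∣ ≡ᵇ n) (allVecs n)))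
  where
    freeOn : Subset n → Set
    freeOn S = T (not (oddUpTo n r (edgesIn {n} {r} G S)))

    spansEven : ∀ {S} → T (∣ S ∣ ≡ᵇ n) → freeOn S
    spansEven {S} |S|≡n = subst freeOn (sym (∣p∣≡n⇒p≡⊤ (≡ᵇ⇒≡ ∣ S ∣ n |S|≡n)))
      (subst (λ i → T (not (oddUpTo n r i))) (sym (edgesIn-⊤ {n} {r} G))
        (even∉oddUpTo n r (even⇒2∣trues (toList G) even)))

f≤2^n^r : ∀ n r k L → f n r k L ≤ 2 ^ (n ^ r)
f≤2^n^r n r k L = begin
  f n r k L                              ≤⟨ length-filter (T? ∘ LkFree {n} {r} L k) (allVecs M) ⟩
  length (allVecs M)                     ≡⟨ length-allVecs M ⟩
  2 ^ M                                  ≡⟨ cong (2 ^_) (length-rSets n r) ⟩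
  2 ^ (n C r)                            ≤⟨ ^-monoʳ-≤ 2 (nCk≤n^k n r) ⟩
  2 ^ (n ^ r)                            ∎
  where
    open ≤-Reasoning
    M = length (rSets n r)

2^[nCr∸1]≤f : ∀ n r → 2 ^ (n C r ∸ 1) ≤ f n r n (oddUpTo n r)
2^[nCr∸1]≤f n r = begin
  2 ^ (n C r ∸ 1)                        ≡⟨ cong (λ m → 2 ^ (m ∸ 1)) (length-rSets n r) ⟨
  2 ^ (M ∸ 1)                            ≡⟨ evenWeight-count M ⟨
  countᵇ (λ G → not (odd? (toList G))) (allVecs M)
    ≤⟨ countᵇ-mono _ (LkFree {n} {r} (oddUpTo n r) n) (allVecs M) (evenGraph⇒free {n} {r}) ⟩
  f n r n (oddUpTo n r)                  ∎
  where
    open ≤-Reasoning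
    M = length (rSets n r)

m≤2*[m∸1] : ∀ {m} → 2 ≤ m → m ≤ 2 * (m ∸ 1)
m≤2*[m∸1] {suc zero}    (s≤s ())
m≤2*[m∸1] {suc (suc k)} _        = s≤s (≤-trans (s≤s (m≤m+n k (k + 0))) (≤-reflexive (sym (+-suc k (k + 0)))))

2^n^r≤f^[2*[2r]^r] : ∀ {n r} → 1 ≤ r → r < n →
  2 ^ (n ^ r) ≤ f n r n (oddUpTo n r) ^ (2 * (2 * r) ^ r)
2^n^r≤f^[2*[2r]^r] {n} {r} 1≤r r<n = begin
  2 ^ (n ^ r)                            ≤⟨ ^-monoʳ-≤ 2 (n^k≤nCk*[2k]^k r (<⇒≤ r<n)) ⟩
  2 ^ (M * D)                            ≤⟨ ^-monoʳ-≤ 2 (*-monoˡ-≤ D (m≤2*[m∸1] 2≤M)) ⟩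
  2 ^ (2 * (M ∸ 1) * D)                  ≡⟨ cong (2 ^_) (trans (cong (_* D) (*-comm 2 (M ∸ 1))) (*-assoc (M ∸ 1) 2 D)) ⟩
  2 ^ ((M ∸ 1) * (2 * D))                ≡⟨ ^-*-assoc 2 (M ∸ 1) (2 * D) ⟨
  (2 ^ (M ∸ 1)) ^ (2 * D)                ≤⟨ ^-monoˡ-≤ (2 * D) (2^[nCr∸1]≤f n r) ⟩
  f n r n (oddUpTo n r) ^ (2 * D)        ∎
  where
    open ≤-Reasoning
    M = n C r
    D = (2 * r) ^ r
    2≤M : 2 ≤ M
    2≤M = ≤-trans (s≤s 1≤r) (1+k≤nCk r<n)

claim2p3 : (r : ℕ) → 2 ≤ r →
    Σ ℕ λ a → Σ ℕ λ b → Σ ℕ λ N → 0 < a ×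
      ((n : ℕ) → N ≤ n →
        (2 ^ (n ^ r) ≤ f n r n (oddUpTo n r) ^ a) × (f n r n (oddUpTo n r) ≤ 2 ^ (b * n ^ r)))
claim2p3 zero ()
claim2p3 r@(suc _) _ = 2 * D , 1 , suc r , 0<2D , λ n r<n →
  2^n^r≤f^[2*[2r]^r] (s≤s z≤n) r<n ,
  subst (λ e → f n r n (oddUpTo n r) ≤ 2 ^ e) (sym (*-identityˡ (n ^ r))) (f≤2^n^r n r n (oddUpTo n r))
  where
    D = (2 * r) ^ r
    0<2D : 0 < 2 * D
    0<2D = ≤-trans (m^n>0 (2 * r) r) (m≤m+n D (D + 0))
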